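{- Let $q=2^m$, where $m$ is a positive integer. Then $$f_4(X)=X^{1+q}+X^{1+q^2}+X^{2q^2+2}$$ is a permutation polynomial over $\mathbb{F}_{q^3}$ if and only if $m\not\equiv 2\pmod 3$.
   Context: A polynomial $f\in\mathbb{F}_{Q}[X]$ is a permutation polynomial over $\mathbb{F}_Q$ if $c\mapsto f(c)$ is a bijection of $\mathbb{F}_Q$. -}

module Defs where

open import Level using (0ℓ)
open import Data.Nat using (ℕ) renaming (_+_ to _+ℕ_; _*_ to _*ℕ_)
open import Data.Fin using (Fin)
open import Data.Product using (_×_; ∃)
open import Relation.Nullary using (¬_)
open import Relation.Binary.PropositionalEquality as ≡ using (_≡_)
open import Algebra.Bundles using (CommutativeRing; Semiring)
open import Function.Bundles using (Bijection)
open import Function.Definitions using (Bijective)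

record IsFieldRing (R : CommutativeRing 0ℓ 0ℓ) : Set where
  open CommutativeRing R
  field
    0≉1     : ¬ (0# ≈ 1#)
    inverse : ∀ x → ¬ (x ≈ 0#) → ∃ λ y → (x * y) ≈ 1#

record FiniteField (Q : ℕ) : Set₁ where
  field
    R       : CommutativeRing 0ℓ 0ℓ
    isField : IsFieldRing R
  open CommutativeRing R public
  field
    card : Bijection (≡.setoid (Fin Q)) setoid

  open import Algebra.Definitions.RawSemiring (Semiring.rawSemiring semiring) public using (_^_)

IsPermutation : ∀ {Q} (F : FiniteField Q) → (FiniteField.Carrier F → FiniteField.Carrier F) → Set
IsPermutation F g = Bijective _≈_ _≈_ g
  where open FiniteField F

f₄ : ∀ {Q} (F : FiniteField Q) (q : ℕ) → FiniteField.Carrier F → FiniteField.Carrier F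
f₄ F q x = (x ^ (1 +ℕ q)) + (x ^ (1 +ℕ (q *ℕ q))) + (x ^ ((2 *ℕ (q *ℕ q)) +ℕ 2))
  where open FiniteField F

{-# OPTIONS --safe #-}
module Submission where

-- Over 𝔽_{q³} (characteristic 2) we have f₄ = L ∘ h with h x = x^(1+q²) and
-- L u = u^q + u + u², and L is additive. The power map h is a bijection: h w = 1 says
-- w · w^(q²) = 1, and applying the Frobenius x ↦ x^q, which has order 3, twice turns this
-- into w² = 1. So f₄ is a permutation iff L has trivial kernel. If L u = 0 then
-- u^q = u + u², and iterating three times gives (u (u³ + u + 1))² = 0, so a nonzero kernel
-- element is a root of X³ + X + 1. Such a root lies in 𝔽₈, hence u^q = u^(2^(m mod 3)), and
-- it lies in the kernel exactly when m ≡ 2 (mod 3). Finally 𝔽_{8^m} does contain a root: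
-- otherwise every value v of the trace Σ_{j<m} x^(8^j) satisfies v⁸ = v and hence v + v² = 0,
-- so a polynomial of degree 2·8^(m-1) < 8^m with X-coefficient 1 would vanish on the field.

open import Level using (0ℓ)
open import Defs
open import Data.Bool using (Bool; true; false; _xor_; _∧_)
import Data.Bool.Properties as Bool
open import Data.Nat as ℕ using (ℕ; zero; suc; z≤n; s≤s)
import Data.Nat.Properties as ℕ
import Data.Nat.DivMod as ℕ
open import Data.Fin as Fin using (Fin; punchOut; punchIn)
import Data.Fin.Properties as Fin
open import Data.Fin.Permutation using (Permutation)
open import Data.List using (List; []; _∷_; length)
open import Data.List.Relation.Unary.All using (All; []; _∷_)
open import Data.Maybe using (map)
open import Data.Product using (_,_; proj₁; proj₂; ∃)
open import Data.Sum using (inj₁; inj₂)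
open import Data.Vec.Functional using (removeAt)
open import Function using (_∘_)
open import Function.Bundles using (Inverse; Bijection; Equivalence; _⇔_; mk⇔)
open import Function.Definitions using (Congruent; Injective; Surjective; Bijective)
open import Function.Properties.Bijection using (Bijection⇒Inverse)
import Function.Construct.Composition as Compose
import Function.Construct.Symmetry as Symmetry
open import Relation.Nullary using (¬_; yes; no; contradiction)
import Relation.Nullary.Decidable as Dec
open import Relation.Binary.Consequences using (dec⇒weaklyDec)
open import Relation.Binary.Definitions using (Decidable; WeaklyDecidable)
open import Relation.Binary.PropositionalEquality as ≡ using (_≡_; _≢_)
open import Algebra.Bundles
  using (Semiring; CommutativeRing; CommutativeMonoid; CancellativeCommutativeSemiring; RawRing)
open import Algebra.Definitions using (AlmostLeftCancellative)
open import Algebra.Solver.Ring.AlmostCommutativeRing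
  using (fromCommutativeRing; _-Raw-AlmostCommutative⟶_; Induced-equivalence)
import Algebra.Properties.CommutativeMonoid.Sum as Sum

module FieldProperties (R : CommutativeRing 0ℓ 0ℓ) (isField : IsFieldRing R) where
  open CommutativeRing R
  open IsFieldRing isField
  open import Algebra.Properties.Semiring.Exp semiring using (_^_; ^-congˡ)
  open import Algebra.Properties.CommutativeSemiring.Exp commutativeSemiring using (^-distrib-*)
  open import Algebra.Properties.Ring ring using ([y-z]x≈yx-zx)
  open import Algebra.Properties.Group +-group using (x∙y⁻¹≈ε⇒x≈y; x≈y⇒x∙y⁻¹≈ε)
  open Sum *-commutativeMonoid using () renaming (sum to ∏)
  open import Relation.Binary.Reasoning.Setoid setoid

  1≉0 : ¬ (1# ≈ 0#)
  1≉0 = 0≉1 ∘ sym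

  module Reciprocal {x} (x≉0 : ¬ (x ≈ 0#)) where
    x⁻¹ : Carrier
    x⁻¹ = proj₁ (inverse x x≉0)

    x*x⁻¹≈1 : x * x⁻¹ ≈ 1#
    x*x⁻¹≈1 = proj₂ (inverse x x≉0)

    x⁻¹*x≈1 : x⁻¹ * x ≈ 1#
    x⁻¹*x≈1 = trans (*-comm x⁻¹ x) x*x⁻¹≈1

    x⁻¹*[x*y]≈y : ∀ y → x⁻¹ * (x * y) ≈ y
    x⁻¹*[x*y]≈y y = begin
      x⁻¹ * (x * y)  ≈⟨ *-assoc x⁻¹ x y ⟨
      (x⁻¹ * x) * y  ≈⟨ *-congʳ x⁻¹*x≈1 ⟩
      1# * y         ≈⟨ *-identityˡ y ⟩
      y              ∎

    x*[x⁻¹*y]≈y : ∀ y → x * (x⁻¹ * y) ≈ y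
    x*[x⁻¹*y]≈y y = begin
      x * (x⁻¹ * y)  ≈⟨ *-assoc x x⁻¹ y ⟨
      (x * x⁻¹) * y  ≈⟨ *-congʳ x*x⁻¹≈1 ⟩
      1# * y         ≈⟨ *-identityˡ y ⟩
      y              ∎

  *-cancelˡ-nonZero : AlmostLeftCancellative _≈_ 0# _*_
  *-cancelˡ-nonZero c x y c≉0 cx≈cy = begin
    x              ≈⟨ x⁻¹*[x*y]≈y x ⟨
    c⁻¹ * (c * x)  ≈⟨ *-congˡ cx≈cy ⟩
    c⁻¹ * (c * y)  ≈⟨ x⁻¹*[x*y]≈y y ⟩
    y              ∎
    where open Reciprocal c≉0 renaming (x⁻¹ to c⁻¹)

  x≉0∧xy≈0⇒y≈0 : ∀ {x y} → ¬ (x ≈ 0#) → x * y ≈ 0# → y ≈ 0#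
  x≉0∧xy≈0⇒y≈0 {x} {y} x≉0 xy≈0 = *-cancelˡ-nonZero x y 0# x≉0 (trans xy≈0 (sym (zeroʳ x)))

  xy≈0∧y≉0⇒x≈0 : ∀ {x y} → x * y ≈ 0# → ¬ (y ≈ 0#) → x ≈ 0#
  xy≈0∧y≉0⇒x≈0 {x} {y} xy≈0 y≉0 = x≉0∧xy≈0⇒y≈0 y≉0 (trans (*-comm y x) xy≈0)

  x≉0∧y≉0⇒xy≉0 : ∀ {x y} → ¬ (x ≈ 0#) → ¬ (y ≈ 0#) → ¬ (x * y ≈ 0#)
  x≉0∧y≉0⇒xy≉0 x≉0 y≉0 = y≉0 ∘ x≉0∧xy≈0⇒y≈0 x≉0

  ∏≉0 : ∀ {n} (g : Fin n → Carrier) → (∀ i → ¬ (g i ≈ 0#)) → ¬ (∏ g ≈ 0#)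
  ∏≉0 {zero}  g _   = 1≉0
  ∏≉0 {suc n} g g≉0 = x≉0∧y≉0⇒xy≉0 (g≉0 Fin.zero) (∏≉0 (g ∘ Fin.suc) (g≉0 ∘ Fin.suc))

  xz≈yz∧x≉y⇒z≈0 : ∀ {x y z} → x * z ≈ y * z → ¬ (x ≈ y) → z ≈ 0#
  xz≈yz∧x≉y⇒z≈0 {x} {y} {z} xz≈yz x≉y = x≉0∧xy≈0⇒y≈0 x-y≉0 (begin
    (x - y) * z    ≈⟨ [y-z]x≈yx-zx z x y ⟩
    x * z - y * z  ≈⟨ x≈y⇒x∙y⁻¹≈ε xz≈yz ⟩
    0#             ∎)
    where
    x-y≉0 : ¬ (x - y ≈ 0#)
    x-y≉0 = x≉y ∘ x∙y⁻¹≈ε⇒x≈y x y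

  cancellativeCommutativeSemiring : CancellativeCommutativeSemiring 0ℓ 0ℓ
  cancellativeCommutativeSemiring = record
    { isCancellativeCommutativeSemiring = record
      { isCommutativeSemiring = isCommutativeSemiring
      ; *-cancelˡ-nonZero     = *-cancelˡ-nonZero
      }
    }

  open CancellativeCommutativeSemiring cancellativeCommutativeSemiring public
    using (*-cancelʳ-nonZero)
  open import Algebra.Properties.CancellativeCommutativeSemiring cancellativeCommutativeSemiring
    public using (xy≈0⇒x≈0∨y≈0)

  module _ (_≟_ : Decidable _≈_) where

    x^n≈0⇒x≈0 : ∀ {x} n → x ^ n ≈ 0# → x ≈ 0#
    x^n≈0⇒x≈0 zero    1≈0   = contradiction 1≈0 1≉0
    x^n≈0⇒x≈0 (suc n) xxⁿ≈0 with xy≈0⇒x≈0∨y≈0 _≟_ xxⁿ≈0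
    ... | inj₁ x≈0  = x≈0
    ... | inj₂ xⁿ≈0 = x^n≈0⇒x≈0 n xⁿ≈0

    ^-injective : ∀ n → (∀ w → w ^ suc n ≈ 1# → w ≈ 1#) →
                  ∀ {x y} → x ^ suc n ≈ y ^ suc n → x ≈ y
    ^-injective n trivialKernel {x} {y} xⁿ≈yⁿ with x ≟ 0#
    ... | yes x≈0 = trans x≈0 (sym (x^n≈0⇒x≈0 (suc n) (begin
      y ^ suc n   ≈⟨ xⁿ≈yⁿ ⟨
      x ^ suc n   ≈⟨ ^-congˡ (suc n) x≈0 ⟩
      0# ^ suc n  ≈⟨ zeroˡ _ ⟩
      0#          ∎)))
    ... | no x≉0 = begin
      x       ≈⟨ *-identityˡ x ⟨
      1# * x  ≈⟨ *-congʳ (trivialKernel w wⁿ≈1) ⟨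
      w * x   ≈⟨ w*x≈y ⟩
      y       ∎
      where
      open Reciprocal x≉0
      w : Carrier
      w = y * x⁻¹
      w*x≈y : w * x ≈ y
      w*x≈y = begin
        (y * x⁻¹) * x  ≈⟨ *-assoc y x⁻¹ x ⟩
        y * (x⁻¹ * x)  ≈⟨ *-congˡ x⁻¹*x≈1 ⟩
        y * 1#         ≈⟨ *-identityʳ y ⟩
        y              ∎
      wⁿ≈1 : w ^ suc n ≈ 1#
      wⁿ≈1 = *-cancelʳ-nonZero (x ^ suc n) (w ^ suc n) 1# (x≉0 ∘ x^n≈0⇒x≈0 (suc n)) (begin
        w ^ suc n * x ^ suc n  ≈⟨ ^-distrib-* w x (suc n) ⟨
        (w * x) ^ suc n        ≈⟨ ^-congˡ (suc n) w*x≈y ⟩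
        y ^ suc n              ≈⟨ xⁿ≈yⁿ ⟨
        x ^ suc n              ≈⟨ *-identityˡ _ ⟨
        1# * x ^ suc n         ∎)

module Powers (S : Semiring 0ℓ 0ℓ) where
  open Semiring S
  open import Algebra.Properties.Semiring.Exp S using (_^_; ^-congˡ; ^-assocʳ)
  open import Relation.Binary.Reasoning.Setoid setoid

  1ⁿ≈1 : ∀ n → 1# ^ n ≈ 1#
  1ⁿ≈1 zero    = refl
  1ⁿ≈1 (suc n) = trans (*-identityˡ _) (1ⁿ≈1 n)

  [xᵐ]ⁿ≈[xⁿ]ᵐ : ∀ x m n → (x ^ m) ^ n ≈ (x ^ n) ^ m
  [xᵐ]ⁿ≈[xⁿ]ᵐ x m n = begin
    (x ^ m) ^ n    ≈⟨ ^-assocʳ x m n ⟩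
    x ^ (m ℕ.* n)  ≡⟨ ≡.cong (x ^_) (ℕ.*-comm m n) ⟩
    x ^ (n ℕ.* m)  ≈⟨ ^-assocʳ x n m ⟨
    (x ^ n) ^ m    ∎

  x⁸≈x⇒x^2ⁿ≈x^2^[n%3] : ∀ {x} → x ^ 8 ≈ x → ∀ n → x ^ (2 ℕ.^ n) ≈ x ^ (2 ℕ.^ (n ℕ.% 3))
  x⁸≈x⇒x^2ⁿ≈x^2^[n%3] x⁸≈x 0 = refl
  x⁸≈x⇒x^2ⁿ≈x^2^[n%3] x⁸≈x 1 = refl
  x⁸≈x⇒x^2ⁿ≈x^2^[n%3] x⁸≈x 2 = refl
  x⁸≈x⇒x^2ⁿ≈x^2^[n%3] {x} x⁸≈x (suc (suc (suc n))) = begin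
    x ^ (2 ℕ.^ (3 ℕ.+ n))          ≡⟨ ≡.cong (x ^_) (ℕ.^-distribˡ-+-* 2 3 n) ⟩
    x ^ (8 ℕ.* 2 ℕ.^ n)            ≈⟨ ^-assocʳ x 8 (2 ℕ.^ n) ⟨
    (x ^ 8) ^ (2 ℕ.^ n)            ≈⟨ ^-congˡ (2 ℕ.^ n) x⁸≈x ⟩
    x ^ (2 ℕ.^ n)                  ≈⟨ x⁸≈x⇒x^2ⁿ≈x^2^[n%3] x⁸≈x n ⟩
    x ^ (2 ℕ.^ (n ℕ.% 3))          ≡⟨ ≡.cong (λ r → x ^ (2 ℕ.^ r)) [3+n]%3≡n%3 ⟨
    x ^ (2 ℕ.^ ((3 ℕ.+ n) ℕ.% 3))  ∎
    where
    [3+n]%3≡n%3 : (3 ℕ.+ n) ℕ.% 3 ≡ n ℕ.% 3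
    [3+n]%3≡n%3 = ≡.trans (≡.cong (ℕ._% 3) (ℕ.+-comm 3 n)) (ℕ.[m+n]%n≡m%n n 3)

Characteristic2 : CommutativeRing 0ℓ 0ℓ → Set
Characteristic2 R = 1# + 1# ≈ 0#
  where open CommutativeRing R

module CharacteristicTwo (R : CommutativeRing 0ℓ 0ℓ) (1+1≈0 : Characteristic2 R) where
  open CommutativeRing R
  open import Algebra.Properties.Semiring.Exp semiring using (_^_; ^-congˡ; ^-assocʳ)
  open import Algebra.Properties.Group +-group using (ε⁻¹≈ε; inverseʳ-unique)
  open import Relation.Binary.Reasoning.Setoid setoid

  -- With coefficients in 𝔽₂ the ring solver below decides identities of characteristic 2;
  -- its constants are con false and con true.
  𝔽₂ : RawRing 0ℓ 0ℓ
  𝔽₂ = CommutativeRing.rawRing Bool.xor-∧-commutativeRing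

  ⟦_⟧₂ : Bool → Carrier
  ⟦ false ⟧₂ = 0#
  ⟦ true  ⟧₂ = 1#

  𝔽₂-homomorphism : 𝔽₂ -Raw-AlmostCommutative⟶ fromCommutativeRing R
  𝔽₂-homomorphism = record
    { ⟦_⟧    = ⟦_⟧₂
    ; +-homo = +-homo
    ; *-homo = *-homo
    ; -‿homo = -‿homo
    ; 0-homo = refl
    ; 1-homo = refl
    }
    where
    +-homo : ∀ a b → ⟦ a xor b ⟧₂ ≈ ⟦ a ⟧₂ + ⟦ b ⟧₂
    +-homo false b     = sym (+-identityˡ ⟦ b ⟧₂)
    +-homo true  false = sym (+-identityʳ 1#)
    +-homo true  true  = sym 1+1≈0
    *-homo : ∀ a b → ⟦ a ∧ b ⟧₂ ≈ ⟦ a ⟧₂ * ⟦ b ⟧₂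
    *-homo false b = sym (zeroˡ ⟦ b ⟧₂)
    *-homo true  b = sym (*-identityˡ ⟦ b ⟧₂)
    -‿homo : ∀ a → ⟦ a ⟧₂ ≈ - ⟦ a ⟧₂
    -‿homo false = sym ε⁻¹≈ε
    -‿homo true  = inverseʳ-unique 1# 1# 1+1≈0

  _≟₂_ : WeaklyDecidable (Induced-equivalence 𝔽₂-homomorphism)
  a ≟₂ b = map (λ { ≡.refl → refl }) (dec⇒weaklyDec Bool._≟_ a b)

  open import Algebra.Solver.Ring 𝔽₂ (fromCommutativeRing R) 𝔽₂-homomorphism _≟₂_ public
    using (solve; _:=_; con; _:+_; _:*_; _:^_)

  x+y≈0⇒x≈y : ∀ {x y} → x + y ≈ 0# → x ≈ y
  x+y≈0⇒x≈y {x} {y} x+y≈0 = begin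
    x            ≈⟨ solve 2 (λ x y → x := (x :+ y) :+ y) refl x y ⟩
    (x + y) + y  ≈⟨ +-congʳ x+y≈0 ⟩
    0# + y       ≈⟨ +-identityˡ y ⟩
    y            ∎

  x≈y⇒x+y≈0 : ∀ {x y} → x ≈ y → x + y ≈ 0#
  x≈y⇒x+y≈0 {x} {y} x≈y = trans (+-congʳ x≈y) (solve 1 (λ y → y :+ y := con false) refl y)

  frobenius-+ : ∀ k x y → (x + y) ^ (2 ℕ.^ k) ≈ x ^ (2 ℕ.^ k) + y ^ (2 ℕ.^ k)
  frobenius-+ zero    x y = solve 2 (λ x y → (x :+ y) :^ 1 := x :^ 1 :+ y :^ 1) refl x y
  frobenius-+ (suc k) x y = begin
    (x + y) ^ (2 ℕ.* n)            ≈⟨ ^-assocʳ (x + y) 2 n ⟨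
    ((x + y) ^ 2) ^ n              ≈⟨ ^-congˡ n [x+y]²≈x²+y² ⟩
    (x ^ 2 + y ^ 2) ^ n            ≈⟨ frobenius-+ k (x ^ 2) (y ^ 2) ⟩
    (x ^ 2) ^ n + (y ^ 2) ^ n      ≈⟨ +-cong (^-assocʳ x 2 n) (^-assocʳ y 2 n) ⟩
    x ^ (2 ℕ.* n) + y ^ (2 ℕ.* n)  ∎
    where
    n : ℕ
    n = 2 ℕ.^ k
    [x+y]²≈x²+y² : (x + y) ^ 2 ≈ x ^ 2 + y ^ 2
    [x+y]²≈x²+y² = solve 2 (λ x y → (x :+ y) :^ 2 := x :^ 2 :+ y :^ 2) refl x y

  tr₈ : ℕ → Carrier → Carrier
  tr₈ zero    x = 0#
  tr₈ (suc k) x = tr₈ k x + x ^ (8 ℕ.^ k)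

  tr₈-^8 : ∀ k x → tr₈ k x ^ 8 + x ≈ tr₈ k x + x ^ (8 ℕ.^ k)
  tr₈-^8 zero    x = solve 1 (λ x → con false :^ 8 :+ x := con false :+ x :^ 1) refl x
  tr₈-^8 (suc k) x = begin
    (T + y) ^ 8 + x                ≈⟨ +-congʳ (frobenius-+ 3 T y) ⟩
    (T ^ 8 + y ^ 8) + x            ≈⟨ solve 3 (λ a b c → (a :+ b) :+ c := (a :+ c) :+ b) refl _ _ x ⟩
    (T ^ 8 + x) + y ^ 8            ≈⟨ +-cong (tr₈-^8 k x) (^-assocʳ x (8 ℕ.^ k) 8) ⟩
    (T + y) + x ^ (8 ℕ.^ k ℕ.* 8)  ≡⟨ ≡.cong (λ n → (T + y) + x ^ n) (ℕ.*-comm (8 ℕ.^ k) 8) ⟩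
    (T + y) + x ^ (8 ℕ.^ suc k)    ∎
    where
    T y : Carrier
    T = tr₈ k x
    y = x ^ (8 ℕ.^ k)

Fin-injective⇒surjective : ∀ {n} {f : Fin n → Fin n} → Injective _≡_ _≡_ f → Surjective _≡_ _≡_ f
Fin-injective⇒surjective {suc n} {f} f-inj j with Fin.any? (λ i → f i Fin.≟ j)
... | yes (i , fi≡j) = i , λ { ≡.refl → fi≡j }
... | no  j∉image     = contradiction (λ {x} {y} → g-inj {x} {y}) (Fin.<⇒notInjective (ℕ.n<1+n n))
  where
  j≢f : ∀ i → j ≢ f i
  j≢f i j≡fi = j∉image (i , ≡.sym j≡fi)
  g : Fin (suc n) → Fin n
  g i = punchOut (j≢f i)
  g-inj : Injective _≡_ _≡_ g
  g-inj {x} {y} = f-inj ∘ Fin.punchOut-injective (j≢f x) (j≢f y)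

module _ {a ℓ} (M : CommutativeMonoid a ℓ) where
  open CommutativeMonoid M
  open Sum M using (sum; sum-remove; sum-cong-≋)
  open import Algebra.Properties.CommutativeSemigroup commutativeSemigroup using (xy∙z≈zy∙x)
  open import Relation.Binary.Reasoning.Setoid setoid

  sum-agreeExcept : ∀ {n} (k : Fin n) (f g : Fin n → Carrier) → (∀ i → i ≢ k → f i ≈ g i) →
                    sum f ∙ g k ≈ sum g ∙ f k
  sum-agreeExcept {suc n} k f g f≈g = begin
    sum f ∙ g k                       ≈⟨ ∙-congʳ (sum-remove {i = k} f) ⟩
    (f k ∙ sum (removeAt f k)) ∙ g k  ≈⟨ ∙-congʳ (∙-congˡ (sum-cong-≋ f≈g-off-k)) ⟩
    (f k ∙ sum (removeAt g k)) ∙ g k  ≈⟨ xy∙z≈zy∙x (f k) _ (g k) ⟩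
    (g k ∙ sum (removeAt g k)) ∙ f k  ≈⟨ ∙-congʳ (sum-remove {i = k} g) ⟨
    sum g ∙ f k                       ∎
    where
    f≈g-off-k : ∀ j → removeAt f k j ≈ removeAt g k j
    f≈g-off-k j = f≈g (punchIn k j) (Fin.punchInᵢ≢i k j)

module FiniteFieldProperties {Q : ℕ} (F : FiniteField Q) where
  open FiniteField F
  open IsFieldRing isField
  open FieldProperties R isField
  open import Algebra.Properties.Semiring.Exp semiring using (^-congˡ)
  open import Algebra.Properties.Semiring.Mult semiring using (_×_; ×1-homo-*)
  open import Algebra.Properties.Group +-group using (identityʳ-unique)
  open import Relation.Binary.Reasoning.Setoid setoid

  enumeration : Inverse (≡.setoid (Fin Q)) setoid
  enumeration = Bijection⇒Inverse card

  open Inverse enumeration public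
    using () renaming (to to element; from to index; from-cong to index-cong)

  element-index : ∀ x → element (index x) ≈ x
  element-index = Inverse.strictlyInverseˡ enumeration

  index-element : ∀ i → index (element i) ≡ i
  index-element = Inverse.strictlyInverseʳ enumeration

  element-injective : Injective _≡_ _≈_ element
  element-injective = Bijection.injective card

  index-injective : ∀ {x y} → index x ≡ index y → x ≈ y
  index-injective {x} {y} ix≡iy = begin
    x                  ≈⟨ element-index x ⟨
    element (index x)  ≡⟨ ≡.cong element ix≡iy ⟩
    element (index y)  ≈⟨ element-index y ⟩
    y                  ∎

  infix 4 _≟_
  _≟_ : Decidable _≈_
  x ≟ y = Dec.map′ index-injective index-cong (index x Fin.≟ index y)

  injective⇒bijective : ∀ {f} → Congruent _≈_ _≈_ f → Injective _≈_ _≈_ f →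
                        Bijective _≈_ _≈_ f
  injective⇒bijective {f} f-cong f-inj = f-inj , f-surj
    where
    f̂ : Fin Q → Fin Q
    f̂ = index ∘ f ∘ element
    f̂-inj : Injective _≡_ _≡_ f̂
    f̂-inj = element-injective ∘ f-inj ∘ index-injective
    f-surj : Surjective _≈_ _≈_ f
    f-surj y with Fin-injective⇒surjective f̂-inj (index y)
    ... | i , f̂i≡iy = element i , λ z≈i → trans (f-cong z≈i) (index-injective (f̂i≡iy ≡.refl))

  mkInverse : (σ τ : Carrier → Carrier) → Congruent _≈_ _≈_ σ → Congruent _≈_ _≈_ τ →
              (∀ x → σ (τ x) ≈ x) → (∀ x → τ (σ x) ≈ x) → Inverse setoid setoid
  mkInverse σ τ σ-cong τ-cong στ τσ = record
    { to        = σ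
    ; from      = τ
    ; to-cong   = σ-cong
    ; from-cong = τ-cong
    ; inverse   = (λ y≈τx → trans (σ-cong y≈τx) (στ _)) ,
                  (λ y≈σx → trans (τ-cong y≈σx) (τσ _))
    }

  module _ (M : CommutativeMonoid 0ℓ 0ℓ) where
    private module M = CommutativeMonoid M
    open Sum M using (sum; sum-permute; sum-cong-≋)

    sum-reindex : (g : Carrier → M.Carrier) → Congruent _≈_ M._≈_ g →
                  (σ : Inverse setoid setoid) →
                  sum (g ∘ element) M.≈ sum (g ∘ Inverse.to σ ∘ element)
    sum-reindex g g-cong σ = M.trans (sum-permute (g ∘ element) π)
      (sum-cong-≋ (λ i → g-cong (element-index (Inverse.to σ (element i)))))
      where
      π : Permutation Q Q
      π = Compose.inverse (Compose.inverse enumeration σ) (Symmetry.inverse enumeration)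

  module ∑ = Sum +-commutativeMonoid
  module ∏ = Sum *-commutativeMonoid

  Q×1≈0 : Q × 1# ≈ 0#
  Q×1≈0 = identityʳ-unique (∑.sum element) (Q × 1#) (begin
    ∑.sum element + Q × 1#                ≈⟨ +-congˡ (∑.sum-replicate Q) ⟨
    ∑.sum element + ∑.sum {Q} (λ _ → 1#)  ≈⟨ ∑.∑-distrib-+ element (λ _ → 1#) ⟨
    ∑.sum (λ i → element i + 1#)          ≈⟨ sum-reindex +-commutativeMonoid (λ x → x) (λ p → p) shift ⟨
    ∑.sum element                         ∎)
    where
    cancel : ∀ {a b} → a + b ≈ 0# → ∀ x → (x + b) + a ≈ x
    cancel {a} {b} a+b≈0 x = begin
      (x + b) + a  ≈⟨ +-assoc x b a ⟩
      x + (b + a)  ≈⟨ +-congˡ (trans (+-comm b a) a+b≈0) ⟩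
      x + 0#       ≈⟨ +-identityʳ x ⟩
      x            ∎
    shift : Inverse setoid setoid
    shift = mkInverse (_+ 1#) (_+ - 1#) +-congʳ +-congʳ
              (cancel (-‿inverseʳ 1#)) (cancel (-‿inverseˡ 1#))

  -- φ replaces 0 by 1, so that ∏ φ is the product of the nonzero elements and
  -- φ (a * x) ≈ a * φ x for every x ≉ 0.
  private
    φ : Carrier → Carrier
    φ x with x ≟ 0#
    ... | yes _ = 1#
    ... | no  _ = x

    φ-cong : Congruent _≈_ _≈_ φ
    φ-cong {x} {y} x≈y with x ≟ 0# | y ≟ 0#
    ... | yes _   | yes _   = refl
    ... | yes x≈0 | no  y≉0 = contradiction (trans (sym x≈y) x≈0) y≉0
    ... | no  x≉0 | yes y≈0 = contradiction (trans x≈y y≈0) x≉0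
    ... | no  _   | no  _   = x≈y

    φ≉0 : ∀ x → ¬ (φ x ≈ 0#)
    φ≉0 x with x ≟ 0#
    ... | yes _   = 1≉0
    ... | no  x≉0 = x≉0

    φ-zero : ∀ {x} → x ≈ 0# → φ x ≈ 1#
    φ-zero {x} x≈0 with x ≟ 0#
    ... | yes _   = refl
    ... | no  x≉0 = contradiction x≈0 x≉0

    φ-nonZero : ∀ {x} → ¬ (x ≈ 0#) → φ x ≈ x
    φ-nonZero {x} x≉0 with x ≟ 0#
    ... | yes x≈0 = contradiction x≈0 x≉0
    ... | no  _   = refl

  fermat : ∀ x → x ^ Q ≈ x
  fermat a with a ≟ 0#
  ... | yes a≈0 = begin
    a ^ Q   ≈⟨ ^-congˡ Q a≈0 ⟩
    0# ^ Q  ≈⟨ 0ⁿ≈0 (index 0#) ⟩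
    0#      ≈⟨ a≈0 ⟨
    a       ∎
    where
    0ⁿ≈0 : ∀ {n} → Fin n → 0# ^ n ≈ 0#
    0ⁿ≈0 {suc n} _ = zeroˡ (0# ^ n)
  ... | no a≉0 = *-cancelʳ-nonZero P (a ^ Q) a (∏≉0 (φ ∘ element) (φ≉0 ∘ element)) (begin
    a ^ Q * P         ≈⟨ *-identityʳ _ ⟨
    (a ^ Q * P) * 1#  ≈⟨ *-cong ∏g≈aᵠP fk≈1 ⟨
    ∏.sum g * f k     ≈⟨ sum-agreeExcept *-commutativeMonoid k f g f≈g ⟨
    ∏.sum f * g k     ≈⟨ *-cong ∏f≈P gk≈a ⟩
    P * a             ≈⟨ *-comm P a ⟩
    a * P             ∎)
    where
    open Reciprocal a≉0 renaming (x⁻¹ to a⁻¹)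
    P : Carrier
    P = ∏.sum (φ ∘ element)
    k : Fin Q
    k = index 0#
    f g : Fin Q → Carrier
    f i = φ (a * element i)
    g i = a * φ (element i)
    scale : Inverse setoid setoid
    scale = mkInverse (a *_) (a⁻¹ *_) *-congˡ *-congˡ x*[x⁻¹*y]≈y x⁻¹*[x*y]≈y
    ∏f≈P : ∏.sum f ≈ P
    ∏f≈P = sym (sum-reindex *-commutativeMonoid φ φ-cong scale)
    ∏g≈aᵠP : ∏.sum g ≈ a ^ Q * P
    ∏g≈aᵠP = trans (∏.∑-distrib-+ (λ _ → a) (φ ∘ element)) (*-congʳ (∏.sum-replicate Q))
    fk≈1 : f k ≈ 1#
    fk≈1 = φ-zero (trans (*-congˡ (element-index 0#)) (zeroʳ a))
    gk≈a : g k ≈ a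
    gk≈a = trans (*-congˡ (φ-zero (element-index 0#))) (*-identityʳ a)
    f≈g : ∀ i → i ≢ k → f i ≈ g i
    f≈g i i≢k = trans (φ-nonZero (x≉0∧y≉0⇒xy≉0 a≉0 eᵢ≉0)) (*-congˡ (sym (φ-nonZero eᵢ≉0)))
      where
      eᵢ≉0 : ¬ (element i ≈ 0#)
      eᵢ≉0 eᵢ≈0 = i≢k (≡.trans (≡.sym (index-element i)) (index-cong eᵢ≈0))

  characteristic-two : ∀ k → Q ≡ 2 ℕ.^ k → Characteristic2 R
  characteristic-two k Q≡2ᵏ = x^n≈0⇒x≈0 _≟_ k (begin
    (1# + 1#) ^ k   ≈⟨ 2ⁿ×1≈[1+1]ⁿ k ⟨
    (2 ℕ.^ k) × 1#  ≡⟨ ≡.cong (_× 1#) Q≡2ᵏ ⟨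
    Q × 1#          ≈⟨ Q×1≈0 ⟩
    0#              ∎)
    where
    2ⁿ×1≈[1+1]ⁿ : ∀ n → (2 ℕ.^ n) × 1# ≈ (1# + 1#) ^ n
    2ⁿ×1≈[1+1]ⁿ zero    = +-identityʳ 1#
    2ⁿ×1≈[1+1]ⁿ (suc n) = trans (×1-homo-* 2 (2 ℕ.^ n))
                                (*-cong (+-congˡ (+-identityʳ 1#)) (2ⁿ×1≈[1+1]ⁿ n))

module Polynomials (R : CommutativeRing 0ℓ 0ℓ) where
  open CommutativeRing R
  open import Algebra.Properties.Semiring.Exp semiring using (_^_)
  open import Algebra.Solver.Ring.NaturalCoefficients.Default commutativeSemiring
    using (solve; _:=_; con; _:+_; _:*_)
  open import Relation.Binary.Reasoning.Setoid setoid

  -- Coefficient lists, constant term first.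
  Polynomial : Set
  Polynomial = List Carrier

  eval : Polynomial → Carrier → Carrier
  eval []      x = 0#
  eval (c ∷ p) x = c + x * eval p x

  IsZero : Polynomial → Set
  IsZero = All (_≈ 0#)

  coeff : Polynomial → ℕ → Carrier
  coeff []      n       = 0#
  coeff (c ∷ p) zero    = c
  coeff (c ∷ p) (suc n) = coeff p n

  X^ : ℕ → Polynomial
  X^ zero    = 1# ∷ []
  X^ (suc n) = 0# ∷ X^ n

  infixl 6 _+ₚ_
  _+ₚ_ : Polynomial → Polynomial → Polynomial
  []      +ₚ q       = q
  (c ∷ p) +ₚ []      = c ∷ p
  (c ∷ p) +ₚ (d ∷ q) = c + d ∷ p +ₚ q

  eval-IsZero : ∀ {p} x → IsZero p → eval p x ≈ 0#
  eval-IsZero x []          = refl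
  eval-IsZero x (c≈0 ∷ p≈0) = begin
    _ + x * _    ≈⟨ +-cong c≈0 (*-congˡ (eval-IsZero x p≈0)) ⟩
    0# + x * 0#  ≈⟨ solve 1 (λ x → con 0 :+ x :* con 0 := con 0) refl x ⟩
    0#           ∎

  coeff-IsZero : ∀ {p} n → IsZero p → coeff p n ≈ 0#
  coeff-IsZero n       []        = refl
  coeff-IsZero zero    (c≈0 ∷ _) = c≈0
  coeff-IsZero (suc n) (_ ∷ p≈0) = coeff-IsZero n p≈0

  eval-X^ : ∀ n x → eval (X^ n) x ≈ x ^ n
  eval-X^ zero    x = solve 1 (λ x → con 1 :+ x :* con 0 := con 1) refl x
  eval-X^ (suc n) x = trans (+-identityˡ _) (*-congˡ (eval-X^ n x))

  coeff-X^-≢ : ∀ {k n} → k ≢ n → coeff (X^ k) n ≈ 0#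
  coeff-X^-≢ {zero}  {zero}  0≢0 = contradiction ≡.refl 0≢0
  coeff-X^-≢ {zero}  {suc n} _   = refl
  coeff-X^-≢ {suc k} {zero}  _   = refl
  coeff-X^-≢ {suc k} {suc n} k≢n = coeff-X^-≢ (k≢n ∘ ≡.cong suc)

  length-X^ : ∀ {n N} → n ℕ.< N → length (X^ n) ℕ.≤ N
  length-X^ {zero}  0<N       = 0<N
  length-X^ {suc n} (s≤s n<N) = s≤s (length-X^ n<N)

  eval-+ₚ : ∀ p q x → eval (p +ₚ q) x ≈ eval p x + eval q x
  eval-+ₚ []      q       x = sym (+-identityˡ _)
  eval-+ₚ (c ∷ p) []      x = sym (+-identityʳ _)
  eval-+ₚ (c ∷ p) (d ∷ q) x = begin
    (c + d) + x * eval (p +ₚ q) x            ≈⟨ +-congˡ (*-congˡ (eval-+ₚ p q x)) ⟩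
    (c + d) + x * (eval p x + eval q x)      ≈⟨ regroup c d x (eval p x) (eval q x) ⟩
    (c + x * eval p x) + (d + x * eval q x)  ∎
    where
    regroup : ∀ c d x P Q → (c + d) + x * (P + Q) ≈ (c + x * P) + (d + x * Q)
    regroup = solve 5 (λ c d x P Q → (c :+ d) :+ x :* (P :+ Q) := (c :+ x :* P) :+ (d :+ x :* Q)) refl

  coeff-+ₚ : ∀ p q n → coeff (p +ₚ q) n ≈ coeff p n + coeff q n
  coeff-+ₚ []      q       n       = sym (+-identityˡ _)
  coeff-+ₚ (c ∷ p) []      n       = sym (+-identityʳ _)
  coeff-+ₚ (c ∷ p) (d ∷ q) zero    = refl
  coeff-+ₚ (c ∷ p) (d ∷ q) (suc n) = coeff-+ₚ p q n

  length-+ₚ : ∀ {n} p q → length p ℕ.≤ n → length q ℕ.≤ n → length (p +ₚ q) ℕ.≤ n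
  length-+ₚ []      q       _         q≤n       = q≤n
  length-+ₚ (c ∷ p) []      p≤n       _         = p≤n
  length-+ₚ (c ∷ p) (d ∷ q) (s≤s p≤n) (s≤s q≤n) = s≤s (length-+ₚ p q p≤n q≤n)

  -- Synthetic division by X - a: the coefficients of the quotient are the values at a
  -- of the tails of p.
  tailValues : Carrier → Polynomial → Polynomial
  tailValues a []      = []
  tailValues a (d ∷ s) = eval (d ∷ s) a ∷ tailValues a s

  quotient : Carrier → Polynomial → Polynomial
  quotient a []      = []
  quotient a (_ ∷ s) = tailValues a s

  length-quotient : ∀ a c s → length (quotient a (c ∷ s)) ≡ length s
  length-quotient a c []      = ≡.refl
  length-quotient a c (d ∷ s) = ≡.cong suc (length-quotient a d s)

  private
    eval-tailValues : ∀ a x s →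
      x * eval s x + a * eval (tailValues a s) x ≈ a * eval s a + x * eval (tailValues a s) x
    eval-tailValues a x []      =
      solve 2 (λ a x → x :* con 0 :+ a :* con 0 := a :* con 0 :+ x :* con 0) refl a x
    eval-tailValues a x (d ∷ s) = begin
      x * (d + x * S) + a * ((d + a * Sₐ) + x * T)   ≈⟨ regroup a x d S Sₐ T ⟩
      a * (d + a * Sₐ) + x * (d + (x * S + a * T))   ≈⟨ +-congˡ (*-congˡ (+-congˡ (eval-tailValues a x s))) ⟩
      a * (d + a * Sₐ) + x * (d + (a * Sₐ + x * T))  ≈⟨ +-congˡ (*-congˡ (+-assoc d _ _)) ⟨
      a * (d + a * Sₐ) + x * ((d + a * Sₐ) + x * T)  ∎
      where
      S Sₐ T : Carrier
      S  = eval s x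
      Sₐ = eval s a
      T  = eval (tailValues a s) x
      regroup : ∀ a x d S Sₐ T →
        x * (d + x * S) + a * ((d + a * Sₐ) + x * T) ≈ a * (d + a * Sₐ) + x * (d + (x * S + a * T))
      regroup = solve 6 (λ a x d S Sₐ T →
        x :* (d :+ x :* S) :+ a :* ((d :+ a :* Sₐ) :+ x :* T)
          := a :* (d :+ a :* Sₐ) :+ x :* (d :+ (x :* S :+ a :* T))) refl

  -- p(x) - p(a) = (x - a) · q(x) for q = quotient a p, rearranged so that no subtraction occurs.
  eval-quotient : ∀ a x p → eval p x + a * eval (quotient a p) x ≈ eval p a + x * eval (quotient a p) x
  eval-quotient a x []      = solve 2 (λ a x → con 0 :+ a :* con 0 := con 0 :+ x :* con 0) refl a x
  eval-quotient a x (c ∷ s) = begin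
    (c + x * eval s x) + a * T  ≈⟨ +-assoc c _ _ ⟩
    c + (x * eval s x + a * T)  ≈⟨ +-congˡ (eval-tailValues a x s) ⟩
    c + (a * eval s a + x * T)  ≈⟨ +-assoc c _ _ ⟨
    (c + a * eval s a) + x * T  ∎
    where
    T : Carrier
    T = eval (tailValues a s) x

  head≈0 : ∀ {c s} a → IsZero s → eval (c ∷ s) a ≈ 0# → c ≈ 0#
  head≈0 {c} {s} a s≈0 root = begin
    c                 ≈⟨ +-identityʳ c ⟨
    c + 0#            ≈⟨ +-congˡ (trans (*-congˡ (eval-IsZero a s≈0)) (zeroʳ a)) ⟨
    c + a * eval s a  ≈⟨ root ⟩
    0#                ∎

  IsZero-tailValues : ∀ a s → IsZero (tailValues a s) → IsZero s
  IsZero-tailValues a []      []              = []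
  IsZero-tailValues a (d ∷ s) (root ∷ tail≈0) = head≈0 a s≈0 root ∷ s≈0
    where
    s≈0 : IsZero s
    s≈0 = IsZero-tailValues a s tail≈0

  module _ (isField : IsFieldRing R) where
    open FieldProperties R isField using (xz≈yz∧x≉y⇒z≈0)

    vanishing⇒IsZero : ∀ {n} (a : Fin n → Carrier) → (∀ {i j} → a i ≈ a j → i ≡ j) →
                       ∀ p → length p ℕ.≤ n → (∀ i → eval p (a i) ≈ 0#) → IsZero p
    vanishing⇒IsZero a a-inj []      _         _    = []
    vanishing⇒IsZero a a-inj (c ∷ s) (s≤s s≤n) root = head≈0 a₀ s≈0 (root Fin.zero) ∷ s≈0
      where
      a₀ : Carrier
      a₀ = a Fin.zero
      q : Polynomial
      q = quotient a₀ (c ∷ s)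
      q-root : ∀ i → eval q (a (Fin.suc i)) ≈ 0#
      q-root i = xz≈yz∧x≉y⇒z≈0 (begin
        a₀ * eval q x                   ≈⟨ +-identityˡ _ ⟨
        0# + a₀ * eval q x              ≈⟨ +-congʳ (root (Fin.suc i)) ⟨
        eval (c ∷ s) x + a₀ * eval q x  ≈⟨ eval-quotient a₀ x (c ∷ s) ⟩
        eval (c ∷ s) a₀ + x * eval q x  ≈⟨ +-congʳ (root Fin.zero) ⟩
        0# + x * eval q x               ≈⟨ +-identityˡ _ ⟩
        x * eval q x                    ∎) (Fin.0≢1+n ∘ a-inj)
        where
        x : Carrier
        x = a (Fin.suc i)
      q≈0 : IsZero q
      q≈0 = vanishing⇒IsZero (a ∘ Fin.suc) (Fin.suc-injective ∘ a-inj) q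
              (≡.subst (ℕ._≤ _) (≡.sym (length-quotient a₀ c s)) s≤n) q-root
      s≈0 : IsZero s
      s≈0 = IsZero-tailValues a₀ s q≈0

module FieldOfOrder8ᵏ {Q : ℕ} (F : FiniteField Q) (k : ℕ) (Q≡8ᵏ : Q ≡ 8 ℕ.^ k) where
  open FiniteField F
  open FieldProperties R isField
  open FiniteFieldProperties F
  open import Algebra.Properties.Semiring.Exp semiring using (^-congˡ; ^-congʳ; ^-assocʳ)
  open import Algebra.Properties.Group +-group using (∙-cancelʳ)
  open import Relation.Binary.Reasoning.Setoid setoid

  1+1≈0 : Characteristic2 R
  1+1≈0 = characteristic-two (3 ℕ.* k) (≡.trans Q≡8ᵏ (ℕ.^-*-assoc 2 3 k))

  open CharacteristicTwo R 1+1≈0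
  open Polynomials R

  x^8ᵏ≈x : ∀ x → x ^ (8 ℕ.^ k) ≈ x
  x^8ᵏ≈x x = trans (^-congʳ x (≡.sym Q≡8ᵏ)) (fermat x)

  trPoly : ℕ → Polynomial
  trPoly zero    = []
  trPoly (suc j) = trPoly j +ₚ (X^ (8 ℕ.^ j) +ₚ X^ (2 ℕ.* 8 ℕ.^ j))

  eval-trPoly : ∀ j x → eval (trPoly j) x ≈ tr₈ j x + tr₈ j x ^ 2
  eval-trPoly zero    x = solve 0 (con false := con false :+ con false :^ 2) refl
  eval-trPoly (suc j) x = begin
    eval (trPoly j +ₚ (X^ (8 ℕ.^ j) +ₚ X^ (2 ℕ.* 8 ℕ.^ j))) x
      ≈⟨ trans (eval-+ₚ (trPoly j) _ x) (+-congˡ (eval-+ₚ (X^ (8 ℕ.^ j)) _ x)) ⟩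
    eval (trPoly j) x + (eval (X^ (8 ℕ.^ j)) x + eval (X^ (2 ℕ.* 8 ℕ.^ j)) x)
      ≈⟨ +-cong (eval-trPoly j x) (+-cong (eval-X^ (8 ℕ.^ j) x) x^[2·8ʲ]≈y²) ⟩
    (T + T ^ 2) + (y + y ^ 2)
      ≈⟨ solve 2 (λ T y → (T :+ T :^ 2) :+ (y :+ y :^ 2) := (T :+ y) :+ (T :+ y) :^ 2) refl T y ⟩
    (T + y) + (T + y) ^ 2 ∎
    where
    T y : Carrier
    T = tr₈ j x
    y = x ^ (8 ℕ.^ j)
    x^[2·8ʲ]≈y² : eval (X^ (2 ℕ.* 8 ℕ.^ j)) x ≈ y ^ 2
    x^[2·8ʲ]≈y² = begin
      eval (X^ (2 ℕ.* 8 ℕ.^ j)) x  ≈⟨ eval-X^ (2 ℕ.* 8 ℕ.^ j) x ⟩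
      x ^ (2 ℕ.* 8 ℕ.^ j)          ≡⟨ ≡.cong (x ^_) (ℕ.*-comm 2 (8 ℕ.^ j)) ⟩
      x ^ (8 ℕ.^ j ℕ.* 2)          ≈⟨ ^-assocʳ x (8 ℕ.^ j) 2 ⟨
      y ^ 2                        ∎

  coeff₁-trPoly : ∀ j → 1 ℕ.≤ j → coeff (trPoly j) 1 ≈ 1#
  coeff₁-trPoly (suc zero)    _ = +-identityʳ 1#
  coeff₁-trPoly (suc (suc j)) _ = begin
    coeff (trPoly (suc j) +ₚ (X^ a +ₚ X^ (2 ℕ.* a))) 1
      ≈⟨ trans (coeff-+ₚ (trPoly (suc j)) _ 1) (+-congˡ (coeff-+ₚ (X^ a) _ 1)) ⟩
    coeff (trPoly (suc j)) 1 + (coeff (X^ a) 1 + coeff (X^ (2 ℕ.* a)) 1)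
      ≈⟨ +-cong (coeff₁-trPoly (suc j) (s≤s z≤n))
                (+-cong (coeff-X^-≢ (ℕ.>⇒≢ 1<a)) (coeff-X^-≢ (ℕ.>⇒≢ 1<2a))) ⟩
    1# + (0# + 0#)
      ≈⟨ solve 0 (con true :+ (con false :+ con false) := con true) refl ⟩
    1# ∎
    where
    a : ℕ
    a = 8 ℕ.^ suc j
    1<a : 1 ℕ.< a
    1<a = ℕ.^-monoʳ-< 8 (s≤s (s≤s z≤n)) {0} {suc j} (s≤s z≤n)
    1<2a : 1 ℕ.< 2 ℕ.* a
    1<2a = ℕ.<-≤-trans 1<a (ℕ.m≤n*m a 2)

  length-trPoly : ∀ j → length (trPoly j) ℕ.≤ 8 ℕ.^ j
  length-trPoly zero    = z≤n
  length-trPoly (suc j) =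
    length-+ₚ (trPoly j) _ (ℕ.≤-trans (length-trPoly j) a≤8a)
      (length-+ₚ (X^ a) _ (length-X^ (ℕ.≤-<-trans (ℕ.m≤n*m a 2) 2a<8a)) (length-X^ 2a<8a))
    where
    a : ℕ
    a = 8 ℕ.^ j
    a≤8a : a ℕ.≤ 8 ℕ.* a
    a≤8a = ℕ.m≤n*m a 8
    2a<8a : 2 ℕ.* a ℕ.< 8 ℕ.* a
    2a<8a = ℕ.≤-trans (ℕ.+-monoˡ-≤ (2 ℕ.* a) (ℕ.m^n>0 8 j))
                      (ℕ.*-monoˡ-≤ a {3} {8} (s≤s (s≤s (s≤s z≤n))))

  X³+X+1-hasRoot : 1 ℕ.≤ k → ∃ λ u → u ^ 3 + u + 1# ≈ 0#
  X³+X+1-hasRoot 1≤k with Fin.any? (λ i → element i ^ 3 + element i + 1# ≟ 0#)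
  ... | yes (i , root) = element i , root
  ... | no  noRoot     = contradiction (trans (sym (coeff₁-trPoly k 1≤k)) (coeff-IsZero 1 trPoly≈0)) 1≉0
    where
    cubic≉0 : ∀ x → ¬ (x ^ 3 + x + 1# ≈ 0#)
    cubic≉0 x root = noRoot (index x , trans (+-congʳ (+-cong (^-congˡ 3 eᵢ≈x) eᵢ≈x)) root)
      where
      eᵢ≈x : element (index x) ≈ x
      eᵢ≈x = element-index x
    tr₈+tr₈²≈0 : ∀ x → tr₈ k x + tr₈ k x ^ 2 ≈ 0#
    tr₈+tr₈²≈0 x = xy≈0∧y≉0⇒x≈0 (xy≈0∧y≉0⇒x≈0 (begin
      ((v + v ^ 2) * (v ^ 3 + v + 1#)) * ((v + 1#) ^ 3 + (v + 1#) + 1#)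
        ≈⟨ solve 1 (λ v → ((v :+ v :^ 2) :* (v :^ 3 :+ v :+ con true))
                          :* ((v :+ con true) :^ 3 :+ (v :+ con true) :+ con true)
                          := v :^ 8 :+ v) refl v ⟩
      v ^ 8 + v
        ≈⟨ x≈y⇒x+y≈0 v⁸≈v ⟩
      0# ∎) (cubic≉0 (v + 1#))) (cubic≉0 v)
      where
      v : Carrier
      v = tr₈ k x
      v⁸≈v : v ^ 8 ≈ v
      v⁸≈v = ∙-cancelʳ x (v ^ 8) v (trans (tr₈-^8 k x) (+-congˡ (x^8ᵏ≈x x)))
    trPoly≈0 : IsZero (trPoly k)
    trPoly≈0 = vanishing⇒IsZero isField element element-injective (trPoly k)
      (≡.subst (length (trPoly k) ℕ.≤_) (≡.sym Q≡8ᵏ) (length-trPoly k))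
      (λ i → trans (eval-trPoly k (element i)) (tr₈+tr₈²≈0 (element i)))

module F₄ (m : ℕ) (F : FiniteField ((2 ℕ.^ m) ℕ.^ 3)) where
  open FiniteField F
  open FieldProperties R isField
  open FiniteFieldProperties F
  open import Algebra.Properties.Semiring.Exp semiring using (^-congˡ; ^-congʳ; ^-assocʳ; ^-homo-*)
  open import Algebra.Properties.CommutativeSemiring.Exp commutativeSemiring using (^-distrib-*)
  open import Relation.Binary.Reasoning.Setoid setoid

  q : ℕ
  q = 2 ℕ.^ m

  q³≡8ᵐ : q ℕ.^ 3 ≡ 8 ℕ.^ m
  q³≡8ᵐ = ≡.trans (ℕ.^-*-assoc 2 m 3)
          (≡.trans (≡.cong (2 ℕ.^_) (ℕ.*-comm m 3)) (≡.sym (ℕ.^-*-assoc 2 3 m)))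

  open FieldOfOrder8ᵏ F m q³≡8ᵐ using (1+1≈0; X³+X+1-hasRoot)
  open CharacteristicTwo R 1+1≈0
  open Powers semiring

  frob : Carrier → Carrier
  frob x = x ^ q

  frob-cong : ∀ {x y} → x ≈ y → frob x ≈ frob y
  frob-cong = ^-congˡ q

  frob-+ : ∀ x y → frob (x + y) ≈ frob x + frob y
  frob-+ = frobenius-+ m

  frob-* : ∀ x y → frob (x * y) ≈ frob x * frob y
  frob-* x y = ^-distrib-* x y q

  frob-1 : frob 1# ≈ 1#
  frob-1 = 1ⁿ≈1 q

  x^[q*q*q]≈x : ∀ x → x ^ (q ℕ.* q ℕ.* q) ≈ x
  x^[q*q*q]≈x x = trans (^-congʳ x q*q*q≡q³) (fermat x)
    where
    q*q*q≡q³ : q ℕ.* q ℕ.* q ≡ q ℕ.^ 3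
    q*q*q≡q³ = ≡.trans (ℕ.*-assoc q q q) (≡.cong (λ n → q ℕ.* (q ℕ.* n)) (≡.sym (ℕ.*-identityʳ q)))

  frob³ : ∀ x → frob (frob (frob x)) ≈ x
  frob³ x = begin
    ((x ^ q) ^ q) ^ q    ≈⟨ ^-congˡ q (^-assocʳ x q q) ⟩
    (x ^ (q ℕ.* q)) ^ q  ≈⟨ ^-assocʳ x (q ℕ.* q) q ⟩
    x ^ (q ℕ.* q ℕ.* q)  ≈⟨ x^[q*q*q]≈x x ⟩
    x                    ∎

  w*frob²w≈1⇒w≈1 : ∀ {w} → w * frob (frob w) ≈ 1# → w ≈ 1#
  w*frob²w≈1⇒w≈1 {w} w*σ²w≈1 = x+y≈0⇒x≈y (x^n≈0⇒x≈0 _≟_ 2 (begin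
    (w + 1#) ^ 2  ≈⟨ solve 1 (λ w → (w :+ con true) :^ 2 := w :* w :+ con true) refl w ⟩
    w * w + 1#    ≈⟨ +-congʳ w*w≈1 ⟩
    1# + 1#       ≈⟨ 1+1≈0 ⟩
    0#            ∎))
    where
    σ : Carrier → Carrier
    σ = frob
    σw*w≈1 : σ w * w ≈ 1#
    σw*w≈1 = begin
      σ w * w            ≈⟨ *-congˡ (frob³ w) ⟨
      σ w * σ (σ (σ w))  ≈⟨ frob-* w (σ (σ w)) ⟨
      σ (w * σ (σ w))    ≈⟨ frob-cong w*σ²w≈1 ⟩
      σ 1#               ≈⟨ frob-1 ⟩
      1#                 ∎
    σ²w*σw≈1 : σ (σ w) * σ w ≈ 1#
    σ²w*σw≈1 = trans (sym (frob-* (σ w) w)) (trans (frob-cong σw*w≈1) frob-1)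
    σ²w≈w : σ (σ w) ≈ w
    σ²w≈w = begin
      σ (σ w)              ≈⟨ *-identityʳ _ ⟨
      σ (σ w) * 1#         ≈⟨ *-congˡ σw*w≈1 ⟨
      σ (σ w) * (σ w * w)  ≈⟨ *-assoc _ _ _ ⟨
      (σ (σ w) * σ w) * w  ≈⟨ *-congʳ σ²w*σw≈1 ⟩
      1# * w               ≈⟨ *-identityˡ w ⟩
      w                    ∎
    w*w≈1 : w * w ≈ 1#
    w*w≈1 = trans (*-congˡ (sym σ²w≈w)) w*σ²w≈1

  h : Carrier → Carrier
  h x = x ^ suc (q ℕ.* q)

  h-injective : ∀ {x y} → h x ≈ h y → x ≈ y
  h-injective = ^-injective _≟_ (q ℕ.* q) λ w hw≈1 →
    w*frob²w≈1⇒w≈1 (trans (*-congˡ (^-assocʳ w q q)) hw≈1)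

  h-surjective : ∀ u → ∃ λ x → h x ≈ u
  h-surjective u with proj₂ (injective⇒bijective (^-congˡ (suc (q ℕ.* q))) h-injective) u
  ... | x , hx≈u = x , hx≈u refl

  L : Carrier → Carrier
  L u = frob u + u + u ^ 2

  L-cong : ∀ {u v} → u ≈ v → L u ≈ L v
  L-cong u≈v = +-cong (+-cong (frob-cong u≈v) u≈v) (^-congˡ 2 u≈v)

  L-+ : ∀ u v → L (u + v) ≈ L u + L v
  L-+ u v = begin
    frob (u + v) + (u + v) + (u + v) ^ 2       ≈⟨ +-congʳ (+-congʳ (frob-+ u v)) ⟩
    (frob u + frob v) + (u + v) + (u + v) ^ 2  ≈⟨ regroup (frob u) (frob v) u v ⟩
    L u + L v                                  ∎
    where
    regroup : ∀ a b u v → (a + b) + (u + v) + (u + v) ^ 2 ≈ (a + u + u ^ 2) + (b + v + v ^ 2)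
    regroup = solve 4 (λ a b u v →
      (a :+ b) :+ (u :+ v) :+ (u :+ v) :^ 2 := (a :+ u :+ u :^ 2) :+ (b :+ v :+ v :^ 2)) refl

  L-0 : L 0# ≈ 0#
  L-0 = identityʳ-unique (L 0#) (L 0#) (trans (sym (L-+ 0# 0#)) (L-cong (+-identityʳ 0#)))
    where open import Algebra.Properties.Group +-group using (identityʳ-unique)

  f₄≈L∘h : ∀ x → f₄ F q x ≈ L (h x)
  f₄≈L∘h x = +-cong (+-congʳ (sym frob[hx]≈x^[1+q])) (sym [hx]²≈x^[2q²+2])
    where
    frob[hx]≈x^[1+q] : frob (h x) ≈ x ^ suc q
    frob[hx]≈x^[1+q] = begin
      (x ^ suc (q ℕ.* q)) ^ q      ≈⟨ ^-assocʳ x (suc (q ℕ.* q)) q ⟩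
      x ^ (q ℕ.+ q ℕ.* q ℕ.* q)    ≈⟨ ^-homo-* x q (q ℕ.* q ℕ.* q) ⟩
      x ^ q * x ^ (q ℕ.* q ℕ.* q)  ≈⟨ *-congˡ (x^[q*q*q]≈x x) ⟩
      x ^ q * x                    ≈⟨ *-comm _ x ⟩
      x * x ^ q                    ∎
    [hx]²≈x^[2q²+2] : h x ^ 2 ≈ x ^ (2 ℕ.* (q ℕ.* q) ℕ.+ 2)
    [hx]²≈x^[2q²+2] = begin
      (x ^ suc (q ℕ.* q)) ^ 2      ≈⟨ ^-assocʳ x (suc (q ℕ.* q)) 2 ⟩
      x ^ (2 ℕ.+ q ℕ.* q ℕ.* 2)    ≡⟨ ≡.cong (x ^_) (ℕ.+-comm 2 (q ℕ.* q ℕ.* 2)) ⟩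
      x ^ (q ℕ.* q ℕ.* 2 ℕ.+ 2)    ≡⟨ ≡.cong (λ n → x ^ (n ℕ.+ 2)) (ℕ.*-comm (q ℕ.* q) 2) ⟩
      x ^ (2 ℕ.* (q ℕ.* q) ℕ.+ 2)  ∎

  L≈0⇒u[u³+u+1]≈0 : ∀ {u} → L u ≈ 0# → u * (u ^ 3 + u + 1#) ≈ 0#
  L≈0⇒u[u³+u+1]≈0 {u} Lu≈0 = x^n≈0⇒x≈0 _≟_ 2 (begin
    (u * (u ^ 3 + u + 1#)) ^ 2  ≈⟨ solve 1 (λ u → let A = u :+ u :^ 2 ; B = A :+ A :^ 2 in
                                     (u :* (u :^ 3 :+ u :+ con true)) :^ 2 := u :+ (B :+ B :^ 2)) refl u ⟩
    u + (B + B ^ 2)             ≈⟨ x≈y⇒x+y≈0 u≈B+B² ⟩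
    0#                          ∎)
    where
    A B : Carrier
    A = u + u ^ 2
    B = A + A ^ 2
    frob-L : ∀ {a b} → frob a ≈ b → frob (a + a ^ 2) ≈ b + b ^ 2
    frob-L {a} frob-a≈b =
      trans (frob-+ a (a ^ 2)) (+-cong frob-a≈b (trans ([xᵐ]ⁿ≈[xⁿ]ᵐ a 2 q) (^-congˡ 2 frob-a≈b)))
    frob-u≈A : frob u ≈ A
    frob-u≈A = x+y≈0⇒x≈y (trans (sym (+-assoc _ u (u ^ 2))) Lu≈0)
    u≈B+B² : u ≈ B + B ^ 2
    u≈B+B² = begin
      u                     ≈⟨ frob³ u ⟨
      frob (frob (frob u))  ≈⟨ frob-cong (frob-cong frob-u≈A) ⟩
      frob (frob A)         ≈⟨ frob-cong (frob-L frob-u≈A) ⟩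
      frob B                ≈⟨ frob-L (frob-L frob-u≈A) ⟩
      B + B ^ 2             ∎

  root≉0 : ∀ {u} → u ^ 3 + u + 1# ≈ 0# → ¬ (u ≈ 0#)
  root≉0 {u} root u≈0 = 1≉0 (begin
    1#                ≈⟨ solve 0 (con true := con false :^ 3 :+ con false :+ con true) refl ⟩
    0# ^ 3 + 0# + 1#  ≈⟨ +-congʳ (+-cong (^-congˡ 3 u≈0) u≈0) ⟨
    u ^ 3 + u + 1#    ≈⟨ root ⟩
    0#                ∎)

  root⇒u⁸≈u : ∀ {u} → u ^ 3 + u + 1# ≈ 0# → u ^ 8 ≈ u
  root⇒u⁸≈u {u} root = begin
    u ^ 8
      ≈⟨ solve 1 (λ u → u :^ 8 := u :+ (u :^ 3 :+ u :+ con true) :* (u :^ 5 :+ u :^ 3 :+ u :^ 2 :+ u))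
               refl u ⟩
    u + (u ^ 3 + u + 1#) * (u ^ 5 + u ^ 3 + u ^ 2 + u)
      ≈⟨ +-congˡ (trans (*-congʳ root) (zeroˡ _)) ⟩
    u + 0#
      ≈⟨ +-identityʳ u ⟩
    u ∎

  u^2ʳ+u+u²≈0⇔r≡2 : ∀ {u} r → r ℕ.< 3 → u ^ 3 + u + 1# ≈ 0# →
                    (u ^ (2 ℕ.^ r) + u + u ^ 2 ≈ 0# ⇔ r ≡ 2)
  u^2ʳ+u+u²≈0⇔r≡2 {u} 0 _ root = mk⇔ (λ L≈0 → contradiction (u≈0 L≈0) (root≉0 root)) λ ()
    where
    u≈0 : u ^ 1 + u + u ^ 2 ≈ 0# → u ≈ 0#
    u≈0 = x^n≈0⇒x≈0 _≟_ 2 ∘ trans (solve 1 (λ u → u :^ 2 := u :^ 1 :+ u :+ u :^ 2) refl u)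
  u^2ʳ+u+u²≈0⇔r≡2 {u} 1 _ root = mk⇔ (λ L≈0 → contradiction (u≈0 L≈0) (root≉0 root)) λ ()
    where
    u≈0 : u ^ 2 + u + u ^ 2 ≈ 0# → u ≈ 0#
    u≈0 = trans (solve 1 (λ u → u := u :^ 2 :+ u :+ u :^ 2) refl u)
  u^2ʳ+u+u²≈0⇔r≡2 {u} 2 _ root = mk⇔ (λ _ → ≡.refl) λ _ → begin
    u ^ 4 + u + u ^ 2
      ≈⟨ solve 1 (λ u → u :^ 4 :+ u :+ u :^ 2 := u :* (u :^ 3 :+ u :+ con true)) refl u ⟩
    u * (u ^ 3 + u + 1#)  ≈⟨ *-congˡ root ⟩
    u * 0#                ≈⟨ zeroʳ u ⟩
    0#                    ∎
  u^2ʳ+u+u²≈0⇔r≡2 (suc (suc (suc _))) (s≤s (s≤s (s≤s ()))) _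

  L≈0⇔m%3≡2 : ∀ {u} → u ^ 3 + u + 1# ≈ 0# → (L u ≈ 0# ⇔ m ℕ.% 3 ≡ 2)
  L≈0⇔m%3≡2 {u} root = mk⇔ (to ∘ trans (sym Lu≈)) (trans Lu≈ ∘ from)
    where
    open Equivalence (u^2ʳ+u+u²≈0⇔r≡2 (m ℕ.% 3) (ℕ.m%n<n m 3) root)
    Lu≈ : L u ≈ u ^ (2 ℕ.^ (m ℕ.% 3)) + u + u ^ 2
    Lu≈ = +-congʳ (+-congʳ (x⁸≈x⇒x^2ⁿ≈x^2^[n%3] (root⇒u⁸≈u root) m))

  L≈0⇒u≈0 : ¬ (m ℕ.% 3 ≡ 2) → ∀ {u} → L u ≈ 0# → u ≈ 0#
  L≈0⇒u≈0 m%3≢2 Lu≈0 with xy≈0⇒x≈0∨y≈0 _≟_ (L≈0⇒u[u³+u+1]≈0 Lu≈0)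
  ... | inj₁ u≈0  = u≈0
  ... | inj₂ root = contradiction (Equivalence.to (L≈0⇔m%3≡2 root) Lu≈0) m%3≢2

  m%3≢2⇒permutation : ¬ (m ℕ.% 3 ≡ 2) → IsPermutation F (f₄ F q)
  m%3≢2⇒permutation m%3≢2 = injective⇒bijective f₄-cong f₄-injective
    where
    f₄-cong : ∀ {x y} → x ≈ y → f₄ F q x ≈ f₄ F q y
    f₄-cong {x} {y} x≈y = begin
      f₄ F q x  ≈⟨ f₄≈L∘h x ⟩
      L (h x)   ≈⟨ L-cong (^-congˡ (suc (q ℕ.* q)) x≈y) ⟩
      L (h y)   ≈⟨ f₄≈L∘h y ⟨
      f₄ F q y  ∎
    f₄-injective : ∀ {x y} → f₄ F q x ≈ f₄ F q y → x ≈ y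
    f₄-injective {x} {y} f₄x≈f₄y = h-injective (x+y≈0⇒x≈y (L≈0⇒u≈0 m%3≢2 (begin
      L (h x + h y)      ≈⟨ L-+ (h x) (h y) ⟩
      L (h x) + L (h y)  ≈⟨ x≈y⇒x+y≈0 Lhx≈Lhy ⟩
      0#                 ∎)))
      where
      Lhx≈Lhy : L (h x) ≈ L (h y)
      Lhx≈Lhy = trans (sym (f₄≈L∘h x)) (trans f₄x≈f₄y (f₄≈L∘h y))

  permutation⇒m%3≢2 : 1 ℕ.≤ m → IsPermutation F (f₄ F q) → ¬ (m ℕ.% 3 ≡ 2)
  permutation⇒m%3≢2 m≥1 (f₄-injective , _) m%3≡2 = root≉0 root (begin
    u     ≈⟨ hx≈u ⟨
    h x   ≈⟨ ^-congˡ (suc (q ℕ.* q)) x≈0 ⟩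
    h 0#  ≈⟨ zeroˡ _ ⟩
    0#    ∎)
    where
    u : Carrier
    u = proj₁ (X³+X+1-hasRoot m≥1)
    root : u ^ 3 + u + 1# ≈ 0#
    root = proj₂ (X³+X+1-hasRoot m≥1)
    x : Carrier
    x = proj₁ (h-surjective u)
    hx≈u : h x ≈ u
    hx≈u = proj₂ (h-surjective u)
    x≈0 : x ≈ 0#
    x≈0 = f₄-injective (begin
      f₄ F q x   ≈⟨ f₄≈L∘h x ⟩
      L (h x)    ≈⟨ L-cong hx≈u ⟩
      L u        ≈⟨ Equivalence.from (L≈0⇔m%3≡2 root) m%3≡2 ⟩
      0#         ≈⟨ L-0 ⟨
      L 0#       ≈⟨ L-cong (zeroˡ _) ⟨
      L (h 0#)   ≈⟨ f₄≈L∘h 0# ⟨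
      f₄ F q 0#  ∎)

open import Data.Nat using (_^_; _%_; _≥_)

theorem3p4 : (m : ℕ) → m ≥ 1 → (F : FiniteField ((2 ^ m) ^ 3)) →
    IsPermutation F (f₄ F (2 ^ m)) ⇔ (¬ (m % 3 ≡ 2))
theorem3p4 m m≥1 F = mk⇔ (permutation⇒m%3≢2 m≥1) m%3≢2⇒permutation
  where open F₄ m F
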